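{- Let $m'$ be an odd positive integer not divisible by $3$. Then there is no generalized bent function $f:\mathbb{Z}_3\to\mathbb{Z}_{2m'}$.
   Context: A function $f:G\to\mathbb{Z}_m$ on a finite abelian group $G$ is a generalized bent function if $\left|\sum_{x\in G}\zeta_m^{f(x)}\chi(x)\right|^2=|G|$ for every character $\chi$ of $G$, where $\zeta_m$ is a primitive $m$-th root of unity. -}

module Defs where

open import Level using (Level)
open import Data.Nat using (ℕ; suc)
import Data.Nat as N
open import Data.Fin using (Fin; toℕ)
open import Data.Sum using (_⊎_)
open import Relation.Nullary using (¬_)
open import Algebra.Bundles using (CommutativeRing; Semiring)
import Algebra.Definitions.RawSemiring as RS
import Algebra.Properties.Monoid.Sum as MS

-- Complex numbers are unavailable, so we work in an
-- arbitrary integral domain of characteristic 0 containing a primitive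
-- N-th root of unity; its subring generated by ζ is isomorphic to ℤ[ζ_N] ⊂ ℂ.
module _ {c ℓ : Level} (R : CommutativeRing c ℓ) where
  open CommutativeRing R
  open RS (Semiring.rawSemiring semiring) using (_^_) renaming (_×_ to _⊗_)
  open MS +-monoid using (sum)

  IsIntegralDomain : Set (c Level.⊔ ℓ)
  IsIntegralDomain = (¬ (1# ≈ 0#)) P.× (∀ x y → x * y ≈ 0# → (x ≈ 0#) ⊎ (y ≈ 0#))
    where import Data.Product as P

  CharZero : Set ℓ
  CharZero = ∀ k → ¬ ((suc k ⊗ 1#) ≈ 0#)

  IsPrimitiveRoot : ℕ → Carrier → Set ℓ
  IsPrimitiveRoot N ζ = (ζ ^ N ≈ 1#) P.× (∀ k → 0 N.< k → k N.< N → ¬ (ζ ^ k ≈ 1#))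
    where import Data.Product as P

  -- Generalized bent function f : ℤ_n → ℤ_m, with ζ a primitive (n*m)-th root
  -- of unity, so ζ_m = ζ^n and ζ_n = ζ^m. The characters of ℤ_n are
  -- χ_a(x) = ζ_n^(a x) for a ∈ ℤ_n. The Walsh coefficient is
  --   W a = Σ_x ζ_m^(f x) χ_a(x) = Σ_x ζ^(n f(x) + m a x),
  -- its complex conjugate is obtained by ζ ↦ ζ⁻¹ = ζ^(nm-1), and
  -- |W a|² = W a · conj(W a) must equal |ℤ_n| = n.
  module _ (n m : ℕ) (ζ : Carrier) (f : Fin n → Fin m) where
    exponent : Fin n → Fin n → ℕ
    exponent a x = n N.* toℕ (f x) N.+ m N.* (toℕ a N.* toℕ x)

    walsh : Fin n → Carrier
    walsh a = sum (λ x → ζ ^ exponent a x)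

    walshConj : Fin n → Carrier
    walshConj a = sum (λ x → ζ ^ ((n N.* m N.∸ 1) N.* exponent a x))

    IsGBent : Set ℓ
    IsGBent = ∀ a → walsh a * walshConj a ≈ (n ⊗ 1#)

module Submission where

-- Let ζ be the primitive 6m'-th root of unity, η = ζ³, ω = ζ^(2m') (a primitive cube root
-- of unity) and u x = η^(f x). The Walsh coefficient at a is the polynomial Σ u x · X^x
-- evaluated at ω^a and its conjugate is Σ ū x · X^x at ω̄^a, so with the correlations
-- C k = Σ u (x + k) · ū x bentness at a reads C 0 + ω^a C 1 + ω̄^a C 2 = 3. As C 0 = 3, the
-- characters a = 0, 1 give a nonsingular linear system forcing C 1 = C 2 = 0. Then
-- α = u 1 ū 0, β = u 2 ū 1, γ = u 0 ū 2 have α+β+γ = C 1 = 0, αβ+βγ+γα = C 2 = 0 and αβγ = 1,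
-- so they are roots of X³ - 1. They are also 2m'-th roots of unity and gcd(3, 2m') = 1,
-- hence α = β = γ = 1 and 3 = C 1 = 0, contradicting characteristic 0.

open import Defs
open import Level using (Level)
import Data.Nat as ℕ
open import Data.Nat using (ℕ; zero; suc; _∸_; s≤s; z≤n)
import Data.Nat.Properties as ℕₚ
open import Data.Nat.Divisibility using (_∣_; _∣?_)
open import Data.Nat.Coprimality using (Coprime; coprime-Bézout)
open import Data.Nat.GCD using (module Bézout)
open import Data.Nat.Primality using (Prime; prime?; prime⇒irreducible; euclidsLemma)
open import Data.Fin using (Fin; toℕ)
open import Data.Fin.Patterns using (0F; 1F; 2F)
open import Data.Product using (_×_; _,_; proj₁; proj₂)
open import Data.Sum using (inj₁; inj₂; [_,_]′)
open import Function using (_∘_)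
open import Relation.Nullary using (¬_; contradiction)
open import Relation.Nullary.Decidable using (from-yes; from-no)
open import Relation.Binary.PropositionalEquality as ≡ using (_≡_)
open import Algebra.Bundles using (Semiring; CommutativeSemiring; CommutativeRing)
import Algebra.Definitions.RawSemiring as RawSemiringDefinitions
import Algebra.Properties.Monoid.Sum as MonoidSum

prime∤⇒coprime : ∀ {p n} → Prime p → ¬ p ∣ n → Coprime p n
prime∤⇒coprime p-prime p∤n (d∣p , d∣n) with prime⇒irreducible p-prime d∣p
... | inj₁ d≡1 = d≡1
... | inj₂ ≡.refl = contradiction d∣n p∤n

3∤m⇒coprime[3,2m] : ∀ {m} → ¬ 3 ∣ m → Coprime 3 (2 ℕ.* m)
3∤m⇒coprime[3,2m] {m} 3∤m = prime∤⇒coprime 3-prime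
  ([ from-no (3 ∣? 2) , 3∤m ]′ ∘ euclidsLemma 2 m 3-prime)
  where
  3-prime : Prime 3
  3-prime = from-yes (prime? 3)

module _ {r ℓ : Level} (S : Semiring r ℓ) where
  open Semiring S
  open import Algebra.Properties.Semiring.Exp S
  open import Relation.Binary.Reasoning.Setoid setoid

  x^m≈1⇒x^[k*m]≈1 : ∀ {x m} → x ^ m ≈ 1# → ∀ k → x ^ (k ℕ.* m) ≈ 1#
  x^m≈1⇒x^[k*m]≈1                     xᵐ≈1 zero    = refl
  x^m≈1⇒x^[k*m]≈1 {x} {m} xᵐ≈1 (suc k) = begin
    x ^ (m ℕ.+ k ℕ.* m)    ≈⟨ ^-homo-* x m (k ℕ.* m) ⟩
    x ^ m * x ^ (k ℕ.* m)  ≈⟨ *-cong xᵐ≈1 (x^m≈1⇒x^[k*m]≈1 xᵐ≈1 k) ⟩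
    1# * 1#                ≈⟨ *-identityˡ 1# ⟩
    1#                     ∎

  x^m≈1⇒[x^k]^m≈1 : ∀ {x m} → x ^ m ≈ 1# → ∀ k → (x ^ k) ^ m ≈ 1#
  x^m≈1⇒[x^k]^m≈1 {x} {m} xᵐ≈1 k = trans (^-assocʳ x k m) (x^m≈1⇒x^[k*m]≈1 xᵐ≈1 k)

  ^-swap : ∀ x m n → (x ^ m) ^ n ≈ (x ^ n) ^ m
  ^-swap x m n = begin
    (x ^ m) ^ n    ≈⟨ ^-assocʳ x m n ⟩
    x ^ (m ℕ.* n)  ≡⟨ ≡.cong (x ^_) (ℕₚ.*-comm m n) ⟩
    x ^ (n ℕ.* m)  ≈⟨ ^-assocʳ x n m ⟨
    (x ^ n) ^ m    ∎

  1+ka≡lb⇒x≈1 : ∀ {x a b} → x ^ a ≈ 1# → x ^ b ≈ 1# → ∀ k l → suc (k ℕ.* a) ≡ l ℕ.* b → x ≈ 1#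
  1+ka≡lb⇒x≈1 {x} {a} {b} xᵃ≈1 xᵇ≈1 k l eq = begin
    x                  ≈⟨ *-identityʳ x ⟨
    x * 1#             ≈⟨ *-congˡ (x^m≈1⇒x^[k*m]≈1 xᵃ≈1 k) ⟨
    x ^ suc (k ℕ.* a)  ≡⟨ ≡.cong (x ^_) eq ⟩
    x ^ (l ℕ.* b)      ≈⟨ x^m≈1⇒x^[k*m]≈1 xᵇ≈1 l ⟩
    1#                 ∎

  coprime⇒x^m≈1⇒x^n≈1⇒x≈1 : ∀ {x m n} → Coprime m n → x ^ m ≈ 1# → x ^ n ≈ 1# → x ≈ 1#
  coprime⇒x^m≈1⇒x^n≈1⇒x≈1 m⊥n xᵐ≈1 xⁿ≈1 with coprime-Bézout m⊥n
  ... | Bézout.+- i j 1+jn≡im = 1+ka≡lb⇒x≈1 xⁿ≈1 xᵐ≈1 j i 1+jn≡im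
  ... | Bézout.-+ i j 1+im≡jn = 1+ka≡lb⇒x≈1 xᵐ≈1 xⁿ≈1 i j 1+im≡jn

module _ {r ℓ : Level} (S : CommutativeSemiring r ℓ) where
  open CommutativeSemiring S
  open import Algebra.Properties.CommutativeSemiring.Exp S

  x^m≈1⇒y^m≈1⇒[x*y]^m≈1 : ∀ {x y m} → x ^ m ≈ 1# → y ^ m ≈ 1# → (x * y) ^ m ≈ 1#
  x^m≈1⇒y^m≈1⇒[x*y]^m≈1 {x} {y} {m} xᵐ≈1 yᵐ≈1 =
    trans (^-distrib-* x y m) (trans (*-cong xᵐ≈1 yᵐ≈1) (*-identityˡ 1#))

module _ {r ℓ : Level} (R : CommutativeRing r ℓ) where
  open CommutativeRing R
  open import Algebra.Properties.CommutativeSemiring.Exp commutativeSemiring using (_^_; ^-congˡ)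
  open RawSemiringDefinitions (Semiring.rawSemiring semiring) using () renaming (_×_ to _⊗_)
  open MonoidSum +-monoid using (sum; sum-cong-≋)
  open import Algebra.Properties.Ring ring using (+-cancelʳ)
  open import Algebra.Solver.Ring.NaturalCoefficients.Default commutativeSemiring
    using (Polynomial; solve; _:=_; _:+_; _:*_; con)
  open import Relation.Binary.Reasoning.Setoid setoid

  poly : ∀ {n} → (Fin n → Carrier) → Carrier → Carrier
  poly u x = sum (λ i → u i * x ^ toℕ i)

  poly-cong : ∀ {n} (u : Fin n → Carrier) {x y} → x ≈ y → poly u x ≈ poly u y
  poly-cong {n} u {x} {y} x≈y = sum-cong-≋ {n} term
    where
    term : ∀ i → u i * x ^ toℕ i ≈ u i * y ^ toℕ i
    term i = *-congˡ (^-congˡ (toℕ i) x≈y)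

  correlation₀ correlation₁ correlation₂ : (Fin 3 → Carrier) → (Fin 3 → Carrier) → Carrier
  correlation₀ u v = u 0F * v 0F + u 1F * v 1F + u 2F * v 2F
  correlation₁ u v = u 1F * v 0F + u 2F * v 1F + u 0F * v 2F
  correlation₂ u v = u 2F * v 0F + u 0F * v 1F + u 1F * v 2F

  poly*poly≈Σcorrelations : ∀ {x y} → x * y ≈ 1# → x ^ 3 ≈ 1# → ∀ u v →
    poly u x * poly v y ≈ correlation₀ u v + (x * correlation₁ u v + y * correlation₂ u v)
  poly*poly≈Σcorrelations {x} {y} xy≈1 x³≈1 u v = begin
    poly u x * poly v y
      ≈⟨ *-congˡ (poly-cong v y≈x²) ⟩
    poly u x * poly v (x * x)
      ≈⟨ +-cancelʳ G _ _ (trans expansion (+-congˡ (trans (*-congʳ x³≈1) (*-identityˡ G)))) ⟩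
    correlation₀ u v + (x * correlation₁ u v + (x * x) * correlation₂ u v)
      ≈⟨ +-congˡ (+-congˡ (*-congʳ y≈x²)) ⟨
    correlation₀ u v + (x * correlation₁ u v + y * correlation₂ u v)
      ∎
    where
    y≈x² : y ≈ x * x
    y≈x² = begin
      y                  ≈⟨ *-identityʳ y ⟨
      y * 1#             ≈⟨ *-congˡ x³≈1 ⟨
      y * x ^ 3          ≈⟨ solve 2 (λ x y → y :* (x :* (x :* (x :* con 1))) := (x :* y) :* (x :* x)) refl x y ⟩
      (x * y) * (x * x)  ≈⟨ *-congʳ xy≈1 ⟩
      1# * (x * x)       ≈⟨ *-identityˡ (x * x) ⟩
      x * x              ∎
    -- poly u x * poly v (x * x) - (right-hand side) = (x³ - 1) * G, written without
    -- subtraction so that the semiring solver applies.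
    G : Carrier
    G = u 1F * v 1F + u 2F * v 2F * (x ^ 3 + 1#) + x * (u 2F * v 1F + u 0F * v 2F) + x * x * (u 1F * v 2F)
    expansion : poly u x * poly v (x * x) + G
              ≈ correlation₀ u v + (x * correlation₁ u v + (x * x) * correlation₂ u v) + x ^ 3 * G
    expansion = solve 7 (λ x u₀ u₁ u₂ v₀ v₁ v₂ →
        let c = x :* (x :* (x :* con 1))
            g = u₁ :* v₁ :+ u₂ :* v₂ :* (c :+ con 1) :+ x :* (u₂ :* v₁ :+ u₀ :* v₂) :+ x :* x :* (u₁ :* v₂)
        in (u₀ :* con 1 :+ (u₁ :* (x :* con 1) :+ (u₂ :* (x :* (x :* con 1)) :+ con 0)))
           :* (v₀ :* con 1 :+ (v₁ :* ((x :* x) :* con 1) :+ (v₂ :* ((x :* x) :* ((x :* x) :* con 1)) :+ con 0)))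
           :+ g
         := (u₀ :* v₀ :+ u₁ :* v₁ :+ u₂ :* v₂)
           :+ (x :* (u₁ :* v₀ :+ u₂ :* v₁ :+ u₀ :* v₂) :+ (x :* x) :* (u₂ :* v₀ :+ u₀ :* v₁ :+ u₁ :* v₂))
           :+ c :* g)
      refl x (u 0F) (u 1F) (u 2F) (v 0F) (v 1F) (v 2F)

  roots-of-x³-1 : ∀ {a b c} → a + b + c ≈ 0# → a * b + b * c + c * a ≈ 0# → a * b * c ≈ 1# →
                  a ^ 3 ≈ 1# × b ^ 3 ≈ 1# × c ^ 3 ≈ 1#
  roots-of-x³-1 {a} {b} {c} e₁≈0 e₂≈0 e₃≈1 =
    root a (solve 3 (λ a b c → vieta a a b c) refl a b c) ,
    root b (solve 3 (λ a b c → vieta b a b c) refl a b c) ,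
    root c (solve 3 (λ a b c → vieta c a b c) refl a b c)
    where
    vieta : ∀ {n} → Polynomial n → Polynomial n → Polynomial n → Polynomial n →
            Polynomial n × Polynomial n
    vieta z a b c = z :* (z :* (z :* con 1)) :+ z :* (a :* b :+ b :* c :+ c :* a)
                 := z :* z :* (a :+ b :+ c) :+ a :* b :* c
    root : ∀ z → z ^ 3 + z * (a * b + b * c + c * a) ≈ z * z * (a + b + c) + a * b * c → z ^ 3 ≈ 1#
    root z identity = begin
      z ^ 3                                    ≈⟨ +-identityʳ (z ^ 3) ⟨
      z ^ 3 + 0#                               ≈⟨ +-congˡ (trans (*-congˡ e₂≈0) (zeroʳ z)) ⟨
      z ^ 3 + z * (a * b + b * c + c * a)      ≈⟨ identity ⟩
      z * z * (a + b + c) + a * b * c          ≈⟨ +-cong (trans (*-congˡ e₁≈0) (zeroʳ (z * z))) e₃≈1 ⟩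
      0# + 1#                                  ≈⟨ +-identityˡ 1# ⟩
      1#                                       ∎

  correlations≈0⇒cubes≈1 : ∀ {u v} → (∀ i → u i * v i ≈ 1#) →
    correlation₁ u v ≈ 0# → correlation₂ u v ≈ 0# →
    (u 1F * v 0F) ^ 3 ≈ 1# × (u 2F * v 1F) ^ 3 ≈ 1# × (u 0F * v 2F) ^ 3 ≈ 1#
  correlations≈0⇒cubes≈1 {u} {v} uv≈1 C₁≈0 C₂≈0 = roots-of-x³-1 C₁≈0 e₂≈0 e₃≈1
    where
    a b c : Carrier
    a = u 1F * v 0F
    b = u 2F * v 1F
    c = u 0F * v 2F
    y≈1⇒xy≈x : ∀ {x y} → y ≈ 1# → x * y ≈ x
    y≈1⇒xy≈x {x} y≈1 = trans (*-congˡ y≈1) (*-identityʳ x)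
    e₂≈0 : a * b + b * c + c * a ≈ 0#
    e₂≈0 = begin
      a * b + b * c + c * a
        ≈⟨ solve 6 (λ u₀ u₁ u₂ v₀ v₁ v₂ →
             (u₁ :* v₀) :* (u₂ :* v₁) :+ (u₂ :* v₁) :* (u₀ :* v₂) :+ (u₀ :* v₂) :* (u₁ :* v₀)
             := u₂ :* v₀ :* (u₁ :* v₁) :+ u₀ :* v₁ :* (u₂ :* v₂) :+ u₁ :* v₂ :* (u₀ :* v₀))
           refl (u 0F) (u 1F) (u 2F) (v 0F) (v 1F) (v 2F) ⟩
      u 2F * v 0F * (u 1F * v 1F) + u 0F * v 1F * (u 2F * v 2F) + u 1F * v 2F * (u 0F * v 0F)
        ≈⟨ +-cong (+-cong (y≈1⇒xy≈x (uv≈1 1F)) (y≈1⇒xy≈x (uv≈1 2F))) (y≈1⇒xy≈x (uv≈1 0F)) ⟩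
      correlation₂ u v
        ≈⟨ C₂≈0 ⟩
      0#  ∎
    e₃≈1 : a * b * c ≈ 1#
    e₃≈1 = begin
      a * b * c
        ≈⟨ solve 6 (λ u₀ u₁ u₂ v₀ v₁ v₂ →
             (u₁ :* v₀) :* (u₂ :* v₁) :* (u₀ :* v₂) := (u₀ :* v₀) :* ((u₁ :* v₁) :* (u₂ :* v₂)))
           refl (u 0F) (u 1F) (u 2F) (v 0F) (v 1F) (v 2F) ⟩
      (u 0F * v 0F) * ((u 1F * v 1F) * (u 2F * v 2F))
        ≈⟨ *-cong (uv≈1 0F) (y≈1⇒xy≈x (uv≈1 2F)) ⟩
      1# * (u 1F * v 1F)
        ≈⟨ trans (*-identityˡ _) (uv≈1 1F) ⟩
      1#  ∎

  x≈1⇒y≈1⇒z≈1⇒x+y+z≈3 : ∀ {x y z} → x ≈ 1# → y ≈ 1# → z ≈ 1# → x + y + z ≈ 3 ⊗ 1#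
  x≈1⇒y≈1⇒z≈1⇒x+y+z≈3 {x} {y} {z} x≈1 y≈1 z≈1 = begin
    x + y + z                ≈⟨ +-cong (+-cong x≈1 y≈1) z≈1 ⟩
    1# + 1# + 1#             ≈⟨ +-assoc 1# 1# 1# ⟩
    1# + (1# + 1#)           ≈⟨ +-congˡ (+-congˡ (+-identityʳ 1#)) ⟨
    1# + (1# + (1# + 0#))    ∎

  xy≈1⇒x³≈1⇒x≉1⇒x≉y : ∀ {x y} → x * y ≈ 1# → x ^ 3 ≈ 1# → ¬ x ≈ 1# → ¬ x ≈ y
  xy≈1⇒x³≈1⇒x≉1⇒x≉y {x} {y} xy≈1 x³≈1 x≉1 x≈y = x≉1 (begin
    x                   ≈⟨ *-identityʳ x ⟨
    x * 1#              ≈⟨ *-congˡ xy≈1 ⟨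
    x * (x * y)         ≈⟨ *-congˡ (*-congˡ (trans (sym x≈y) (sym (*-identityʳ x)))) ⟩
    x * (x * (x * 1#))  ≈⟨ x³≈1 ⟩
    1#                  ∎)

module _ {r ℓ : Level} (R : CommutativeRing r ℓ) (domain : IsIntegralDomain R) where
  open CommutativeRing R
  open import Algebra.Properties.Ring ring using ([y-z]x≈yx-zx; x≈y⇒x∙y⁻¹≈ε; x∙y⁻¹≈ε⇒x≈y; +-cancelˡ)
  open import Relation.Binary.Reasoning.Setoid setoid

  x≉y⇒xz≈yz⇒z≈0 : ∀ {x y z} → ¬ x ≈ y → x * z ≈ y * z → z ≈ 0#
  x≉y⇒xz≈yz⇒z≈0 {x} {y} {z} x≉y xz≈yz
    with proj₂ domain (x - y) z (trans ([y-z]x≈yx-zx z x y) (x≈y⇒x∙y⁻¹≈ε xz≈yz))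
  ... | inj₁ x-y≈0 = contradiction (x∙y⁻¹≈ε⇒x≈y x y x-y≈0) x≉y
  ... | inj₂ z≈0   = z≈0

  x≉y⇒a+b≈0⇒xa+yb≈0⇒a≈0×b≈0 : ∀ {x y a b} → ¬ x ≈ y →
    a + b ≈ 0# → x * a + y * b ≈ 0# → a ≈ 0# × b ≈ 0#
  x≉y⇒a+b≈0⇒xa+yb≈0⇒a≈0×b≈0 {x} {y} {a} {b} x≉y a+b≈0 xa+yb≈0 = a≈0 , b≈0
    where
    xb≈yb : x * b ≈ y * b
    xb≈yb = +-cancelˡ (x * a) (x * b) (y * b) (begin
      x * a + x * b  ≈⟨ distribˡ x a b ⟨
      x * (a + b)    ≈⟨ *-congˡ a+b≈0 ⟩
      x * 0#         ≈⟨ zeroʳ x ⟩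
      0#             ≈⟨ xa+yb≈0 ⟨
      x * a + y * b  ∎)
    b≈0 : b ≈ 0#
    b≈0 = x≉y⇒xz≈yz⇒z≈0 x≉y xb≈yb
    a≈0 : a ≈ 0#
    a≈0 = begin
      a       ≈⟨ +-identityʳ a ⟨
      a + 0#  ≈⟨ +-congˡ b≈0 ⟨
      a + b   ≈⟨ a+b≈0 ⟩
      0#      ∎

module WalshOnℤ₃ {r ℓ : Level} (R : CommutativeRing r ℓ) (domain : IsIntegralDomain R)
  (p : ℕ) (ζ : CommutativeRing.Carrier R) (ζ-primitive : IsPrimitiveRoot R (3 ℕ.* (2 ℕ.* suc p)) ζ) where

  open CommutativeRing R
  open import Algebra.Properties.CommutativeSemiring.Exp commutativeSemiring
  open import Algebra.Properties.Ring ring using (+-cancelˡ)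
  open RawSemiringDefinitions (Semiring.rawSemiring semiring) using () renaming (_×_ to _⊗_)
  open MonoidSum +-monoid using (sum-cong-≋)
  open import Relation.Binary.Reasoning.Setoid setoid

  M N : ℕ
  M = 2 ℕ.* suc p
  N = 3 ℕ.* M

  -- z * conj z unfolds to z ^ N, so conj inverts every N-th root of unity.
  conj : Carrier → Carrier
  conj z = z ^ (N ∸ 1)

  conj-^ : ∀ z k → conj (z ^ k) ≈ conj z ^ k
  conj-^ z k = ^-swap semiring z k (N ∸ 1)

  ζᴺ≈1 : ζ ^ N ≈ 1#
  ζᴺ≈1 = proj₁ ζ-primitive

  [ζᵏ]ᴺ≈1 : ∀ k → (ζ ^ k) ^ N ≈ 1#
  [ζᵏ]ᴺ≈1 = x^m≈1⇒[x^k]^m≈1 semiring {ζ} {N} ζᴺ≈1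

  ζ^[[N∸1]e]≈conj[ζ^e] : ∀ e → ζ ^ ((N ∸ 1) ℕ.* e) ≈ conj (ζ ^ e)
  ζ^[[N∸1]e]≈conj[ζ^e] e = begin
    ζ ^ ((N ∸ 1) ℕ.* e)  ≡⟨ ≡.cong (ζ ^_) (ℕₚ.*-comm (N ∸ 1) e) ⟩
    ζ ^ (e ℕ.* (N ∸ 1))  ≈⟨ ^-assocʳ ζ e (N ∸ 1) ⟨
    conj (ζ ^ e)         ∎

  η ω : Carrier
  η = ζ ^ 3
  ω = ζ ^ M

  ηᴹ≈1 : η ^ M ≈ 1#
  ηᴹ≈1 = trans (^-assocʳ ζ 3 M) ζᴺ≈1

  ω³≈1 : ω ^ 3 ≈ 1#
  ω³≈1 = trans (^-assocʳ ζ M 3) (trans (^-congʳ ζ (ℕₚ.*-comm M 3)) ζᴺ≈1)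

  ω≉1 : ¬ ω ≈ 1#
  ω≉1 = proj₂ ζ-primitive M (s≤s z≤n) (ℕₚ.m<m+n M (s≤s z≤n))

  ωᵃ*conj[ω]ᵃ≈1 : ∀ a → ω ^ a * conj ω ^ a ≈ 1#
  ωᵃ*conj[ω]ᵃ≈1 a = trans (*-congˡ (sym (conj-^ ω a))) (x^m≈1⇒[x^k]^m≈1 semiring {ω} {N} ([ζᵏ]ᴺ≈1 M) a)

  [ωᵃ]³≈1 : ∀ a → (ω ^ a) ^ 3 ≈ 1#
  [ωᵃ]³≈1 = x^m≈1⇒[x^k]^m≈1 semiring {ω} {3} ω³≈1

  ω¹≉conj[ω]¹ : ¬ ω ^ 1 ≈ conj ω ^ 1
  ω¹≉conj[ω]¹ = xy≈1⇒x³≈1⇒x≉1⇒x≉y R (ωᵃ*conj[ω]ᵃ≈1 1) ([ωᵃ]³≈1 1) (ω≉1 ∘ trans (sym (*-identityʳ ω)))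

  ζ^[3k+M[ai]]≈ηᵏ[ωᵃ]ⁱ : ∀ k a i → ζ ^ (3 ℕ.* k ℕ.+ M ℕ.* (a ℕ.* i)) ≈ η ^ k * (ω ^ a) ^ i
  ζ^[3k+M[ai]]≈ηᵏ[ωᵃ]ⁱ k a i = begin
    ζ ^ (3 ℕ.* k ℕ.+ M ℕ.* (a ℕ.* i))     ≈⟨ ^-homo-* ζ (3 ℕ.* k) (M ℕ.* (a ℕ.* i)) ⟩
    ζ ^ (3 ℕ.* k) * ζ ^ (M ℕ.* (a ℕ.* i))  ≈⟨ *-congˡ (^-assocʳ ζ M (a ℕ.* i)) ⟨
    ζ ^ (3 ℕ.* k) * ω ^ (a ℕ.* i)          ≈⟨ *-cong (^-assocʳ ζ 3 k) (^-assocʳ ω a i) ⟨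
    η ^ k * (ω ^ a) ^ i                    ∎

  module _ (f : Fin 3 → Fin M) where

    u ū : Fin 3 → Carrier
    u i = η ^ toℕ (f i)
    ū = conj ∘ u

    u*ū≈1 : ∀ i → u i * ū i ≈ 1#
    u*ū≈1 i = x^m≈1⇒[x^k]^m≈1 semiring {η} {N} ([ζᵏ]ᴺ≈1 3) (toℕ (f i))

    walsh≈poly : ∀ a → walsh R 3 M ζ f a ≈ poly R u (ω ^ toℕ a)
    walsh≈poly a = sum-cong-≋ {3} (λ i → ζ^[3k+M[ai]]≈ηᵏ[ωᵃ]ⁱ (toℕ (f i)) (toℕ a) (toℕ i))

    walshConj≈poly : ∀ a → walshConj R 3 M ζ f a ≈ poly R ū (conj ω ^ toℕ a)
    walshConj≈poly a = sum-cong-≋ {3} term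
      where
      term : ∀ i → ζ ^ ((N ∸ 1) ℕ.* exponent R 3 M ζ f a i) ≈ ū i * (conj ω ^ toℕ a) ^ toℕ i
      term i = begin
        ζ ^ ((N ∸ 1) ℕ.* exponent R 3 M ζ f a i)
          ≈⟨ ζ^[[N∸1]e]≈conj[ζ^e] (exponent R 3 M ζ f a i) ⟩
        conj (ζ ^ exponent R 3 M ζ f a i)
          ≈⟨ ^-congˡ (N ∸ 1) (ζ^[3k+M[ai]]≈ηᵏ[ωᵃ]ⁱ (toℕ (f i)) (toℕ a) (toℕ i)) ⟩
        conj (u i * (ω ^ toℕ a) ^ toℕ i)
          ≈⟨ ^-distrib-* (u i) ((ω ^ toℕ a) ^ toℕ i) (N ∸ 1) ⟩
        ū i * conj ((ω ^ toℕ a) ^ toℕ i)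
          ≈⟨ *-congˡ (trans (conj-^ (ω ^ toℕ a) (toℕ i)) (^-congˡ (toℕ i) (conj-^ ω (toℕ a)))) ⟩
        ū i * (conj ω ^ toℕ a) ^ toℕ i
          ∎

    bent⇒twisted-correlations≈0 : IsGBent R 3 M ζ f →
      ∀ a → ω ^ toℕ a * correlation₁ R u ū + conj ω ^ toℕ a * correlation₂ R u ū ≈ 0#
    bent⇒twisted-correlations≈0 bent a = +-cancelˡ (correlation₀ R u ū) _ _ (begin
      correlation₀ R u ū + (ω ^ toℕ a * correlation₁ R u ū + conj ω ^ toℕ a * correlation₂ R u ū)
        ≈⟨ poly*poly≈Σcorrelations R (ωᵃ*conj[ω]ᵃ≈1 (toℕ a)) ([ωᵃ]³≈1 (toℕ a)) u ū ⟨
      poly R u (ω ^ toℕ a) * poly R ū (conj ω ^ toℕ a)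
        ≈⟨ *-cong (walsh≈poly a) (walshConj≈poly a) ⟨
      walsh R 3 M ζ f a * walshConj R 3 M ζ f a
        ≈⟨ bent a ⟩
      3 ⊗ 1#
        ≈⟨ x≈1⇒y≈1⇒z≈1⇒x+y+z≈3 R (u*ū≈1 0F) (u*ū≈1 1F) (u*ū≈1 2F) ⟨
      correlation₀ R u ū
        ≈⟨ +-identityʳ _ ⟨
      correlation₀ R u ū + 0#
        ∎)

    bent⇒correlations≈0 : IsGBent R 3 M ζ f → correlation₁ R u ū ≈ 0# × correlation₂ R u ū ≈ 0#
    bent⇒correlations≈0 bent = x≉y⇒a+b≈0⇒xa+yb≈0⇒a≈0×b≈0 R domain ω¹≉conj[ω]¹
      (trans (sym (+-cong (*-identityˡ _) (*-identityˡ _))) (bent⇒twisted-correlations≈0 bent 0F))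
      (bent⇒twisted-correlations≈0 bent 1F)

    u*ū³≈1⇒u*ū≈1 : ¬ 3 ∣ suc p → ∀ i j → (u i * ū j) ^ 3 ≈ 1# → u i * ū j ≈ 1#
    u*ū³≈1⇒u*ū≈1 3∤m' i j cube≈1 =
      coprime⇒x^m≈1⇒x^n≈1⇒x≈1 semiring (3∤m⇒coprime[3,2m] 3∤m') cube≈1
        (x^m≈1⇒y^m≈1⇒[x*y]^m≈1 commutativeSemiring {u i} {ū j} {M} (uᴹ≈1 i)
          (x^m≈1⇒[x^k]^m≈1 semiring {u j} {M} (uᴹ≈1 j) (N ∸ 1)))
      where
      uᴹ≈1 : ∀ k → u k ^ M ≈ 1#
      uᴹ≈1 k = x^m≈1⇒[x^k]^m≈1 semiring {η} {M} ηᴹ≈1 (toℕ (f k))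

open import Data.Nat using (_*_)

corollary4p3 : ∀ {c ℓ : Level} (m' : ℕ) → 0 Data.Nat.< m' → ¬ (2 ∣ m') → ¬ (3 ∣ m')
    → (R : CommutativeRing c ℓ) → IsIntegralDomain R → CharZero R
    → (ζ : CommutativeRing.Carrier R) → IsPrimitiveRoot R (3 * (2 * m')) ζ
    → (f : Fin 3 → Fin (2 * m')) → ¬ IsGBent R 3 (2 * m') ζ f
corollary4p3 (suc p) _ _ 3∤m' R domain charZero ζ ζ-primitive f bent =
  let open CommutativeRing R using (trans; sym)
      open WalshOnℤ₃ R domain p ζ ζ-primitive
      C₁≈0 , C₂≈0 = bent⇒correlations≈0 f bent
      α³≈1 , β³≈1 , γ³≈1 = correlations≈0⇒cubes≈1 R (u*ū≈1 f) C₁≈0 C₂≈0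
      cube-root≈1 = u*ū³≈1⇒u*ū≈1 f 3∤m'
      3≈C₁ = sym (x≈1⇒y≈1⇒z≈1⇒x+y+z≈3 R
        (cube-root≈1 1F 0F α³≈1) (cube-root≈1 2F 1F β³≈1) (cube-root≈1 0F 2F γ³≈1))
  in charZero 2 (trans 3≈C₁ C₁≈0)
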